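{- For every integer $m\ge3$ there exists an index $n_m\in\mathbb{N}$ with $n_m\le 3^{m-1}$ such that both integers $\tilde P_{n_m}(2)$ and $\tilde Q_{n_m}(2)$ are divisible by $3^m$.
   Context: Let $\hat P_9(z)=z^8-3z^6+2z^4+3z^2-4$ and $\hat Q_9(z)=(z+1)(z^8-z^6+z^2+2)$. For $n\in\mathbb{N}$ define $\tilde P_n(z)=\prod_{k=0}^{n}(z^{2^k}-1)\cdot\hat P_9(z^{2^{n+1}})$ and $\tilde Q_n(z)=\hat Q_9(z^{2^{n+1}})$. -}

module Defs where

open import Data.Nat as ℕ using (ℕ; zero; suc)
open import Data.Integer using (ℤ; +_; _+_; _-_; _*_; _^_)

P̂₉ : ℤ → ℤ
P̂₉ z = z ^ 8 - + 3 * z ^ 6 + + 2 * z ^ 4 + + 3 * z ^ 2 - + 4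

Q̂₉ : ℤ → ℤ
Q̂₉ z = (z + + 1) * (z ^ 8 - z ^ 6 + z ^ 2 + + 2)

prodFactor : ℤ → ℕ → ℤ
prodFactor z zero    = z ^ (2 ℕ.^ 0) - + 1
prodFactor z (suc n) = prodFactor z n * (z ^ (2 ℕ.^ suc n) - + 1)

P̃ : ℕ → ℤ → ℤ
P̃ n z = prodFactor z n * P̂₉ (z ^ (2 ℕ.^ suc n))

Q̃ : ℕ → ℤ → ℤ
Q̃ n z = Q̂₉ (z ^ (2 ℕ.^ suc n))

{-# OPTIONS --safe #-}
-- Write u n = 4 ^ 2 ^ n = 2 ^ 2 ^ (n + 1), the point at which P̂₉ and Q̂₉ are evaluated. Then
-- u n = 1 + 3 w with 3 ∤ w, so 3 ^ n divides the product in P̃ n 2, while Q̃ n 2 = (u n + 1) g (u n)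
-- with g z = z⁸ - z⁶ + z² + 2. As 2 generates the units modulo powers of 3, moving n to
-- n + j · 2 · 3 ^ i changes u n by 3 ^ (i + 2) j w modulo 3 ^ (i + 3); since g′(u n) ≡ 1 (mod 3),
-- g (u n) changes by the same amount. This is Hensel's lemma along the sequence: starting from
-- 9 ∣ g 16, one of j = 0, 1, 2 raises the power of 3 dividing g (u n) while keeping n < 2 · 3 ^ i,
-- and a last shift by a full period makes n ≥ m without exceeding 3 ^ (m - 1).
module Submission where

open import Defs

module PowersOfFour where
  open import Data.Nat
  open import Data.Nat.Properties
  open import Data.List using ([]; _∷_)
  open import Data.Nat.Divisibility using (_∣_; divides; n∣m*n; m∣m*n; ∣m+n∣m⇒∣n; ∣1⇒≡1)
  open import Data.Product
  open import Relation.Nullary using (¬_)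
  open import Function using (case_of_)
  open import Relation.Binary.PropositionalEquality
  open import Data.Nat.Tactic.RingSolver
  import Relation.Binary.Reasoning.Base.Single as SingleReasoning

  infix 4 _≡_mod_

  -- One-sided: the quotient is a natural number, so y ≤ x.
  record _≡_mod_ (x y m : ℕ) : Set where
    constructor congruent
    field
      quotient : ℕ
      equality : x ≡ y + m * quotient

  ≡-mod-refl : ∀ {x m} → x ≡ x mod m
  ≡-mod-refl {x} {m} = congruent 0 (solve (x ∷ m ∷ []))

  ≡-mod-trans : ∀ {x y z m} → x ≡ y mod m → y ≡ z mod m → x ≡ z mod m
  ≡-mod-trans {z = z} {m = m} (congruent r refl) (congruent s refl) =
    congruent (s + r) (solve (z ∷ m ∷ s ∷ r ∷ []))

  module ≡-mod-Reasoning (m : ℕ) = SingleReasoning (λ x y → x ≡ y mod m) ≡-mod-refl ≡-mod-trans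

  ≡⇒≡-mod : ∀ {x y m} → x ≡ y → x ≡ y mod m
  ≡⇒≡-mod refl = ≡-mod-refl

  ≡-mod-weaken : ∀ {x y m n} → m ∣ n → x ≡ y mod n → x ≡ y mod m
  ≡-mod-weaken {y = y} {m} (divides k refl) (congruent r refl) =
    congruent (k * r) (solve (y ∷ m ∷ k ∷ r ∷ []))

  *-cong-mod : ∀ {a b c d m} → a ≡ b mod m → c ≡ d mod m → a * c ≡ b * d mod m
  *-cong-mod {b = b} {d = d} {m} (congruent r refl) (congruent s refl) =
    congruent (r * d + b * s + m * r * s) (solve (b ∷ d ∷ m ∷ r ∷ s ∷ []))

  *-congˡ-mod : ∀ {b c m} a → b ≡ c mod m → a * b ≡ a * c mod m
  *-congˡ-mod a = *-cong-mod (≡-mod-refl {a})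

  ^-cong-mod : ∀ {a b m} j → a ≡ b mod m → a ^ j ≡ b ^ j mod m
  ^-cong-mod zero    a≡b = ≡-mod-refl
  ^-cong-mod (suc j) a≡b = *-cong-mod a≡b (^-cong-mod j a≡b)

  binomial-mod : ∀ m x j → (1 + m * x) ^ j ≡ 1 + j * (m * x) mod m * m
  binomial-mod m x zero    = ≡-mod-refl
  binomial-mod m x (suc j) = begin
    (1 + m * x) * (1 + m * x) ^ j                ∼⟨ *-congˡ-mod (1 + m * x) (binomial-mod m x j) ⟩
    (1 + m * x) * (1 + j * (m * x))              ≡⟨ solve (m ∷ x ∷ j ∷ []) ⟩
    1 + (1 + j) * (m * x) + m * m * (j * x * x)  ∼⟨ congruent _ refl ⟩
    1 + (1 + j) * (m * x)                        ∎
    where open ≡-mod-Reasoning (m * m)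

  cube-lift : ∀ {x} k u → x ≡ 1 + 3 ^ suc k * u mod 3 ^ suc (suc k) →
              x ^ 3 ≡ 1 + 3 ^ suc (suc k) * u mod 3 ^ suc (suc (suc k))
  cube-lift k u (congruent r refl) = congruent _ (cube (3 ^ k) u r)
    where
    -- x ^ 3 is spelled out with _*_ because the reflective solver does not interpret _^_.
    cube : ∀ q u r → let x = 1 + 3 * q * u + 3 * (3 * q) * r ; v = u + 3 * r in
           x * (x * (x * 1)) ≡ 1 + 3 * (3 * q) * u + 3 * (3 * (3 * q)) * (r + q * v * v + q * q * v * v * v)
    cube = solve-∀

  3^[2+a]∣3^[1+a]² : ∀ a → 3 ^ (2 + a) ∣ 3 ^ (1 + a) * 3 ^ (1 + a)
  3^[2+a]∣3^[1+a]² a = divides (3 ^ a) (square (3 ^ a))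
    where
    square : ∀ q → 3 * q * (3 * q) ≡ q * (3 * (3 * q))
    square = solve-∀

  binomial-3-mod : ∀ a x j → (1 + 3 ^ suc a * x) ^ j ≡ 1 + j * (3 ^ suc a * x) mod 3 ^ suc (suc a)
  binomial-3-mod a x j = ≡-mod-weaken (3^[2+a]∣3^[1+a]² a) (binomial-mod (3 ^ suc a) x j)

  lifting-the-exponent : ∀ k u → (1 + 3 * u) ^ 3 ^ k ≡ 1 + 3 ^ suc k * u mod 3 ^ suc (suc k)
  lifting-the-exponent zero    u = ≡⇒≡-mod (^-identityʳ (1 + 3 * u))
  lifting-the-exponent (suc k) u = begin
    (1 + 3 * u) ^ (3 * 3 ^ k)    ≡⟨ cong ((1 + 3 * u) ^_) (*-comm 3 (3 ^ k)) ⟩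
    (1 + 3 * u) ^ (3 ^ k * 3)    ≡⟨ ^-*-assoc (1 + 3 * u) (3 ^ k) 3 ⟨
    ((1 + 3 * u) ^ 3 ^ k) ^ 3    ∼⟨ cube-lift k u (lifting-the-exponent k u) ⟩
    1 + 3 ^ suc (suc k) * u      ∎
    where open ≡-mod-Reasoning (3 ^ suc (suc (suc k)))

  two-power-period : ∀ i j → 2 ^ (j * (2 * 3 ^ i)) ≡ 1 + j * 3 ^ suc i mod 3 ^ suc (suc i)
  two-power-period i j = begin
    2 ^ (j * (2 * 3 ^ i))         ≡⟨ cong (2 ^_) (*-comm j (2 * 3 ^ i)) ⟩
    2 ^ (2 * 3 ^ i * j)           ≡⟨ ^-*-assoc 2 (2 * 3 ^ i) j ⟨
    (2 ^ (2 * 3 ^ i)) ^ j         ≡⟨ cong (_^ j) (^-*-assoc 2 2 (3 ^ i)) ⟨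
    (4 ^ 3 ^ i) ^ j               ∼⟨ ^-cong-mod j (lifting-the-exponent i 1) ⟩
    (1 + 3 ^ suc i * 1) ^ j       ∼⟨ binomial-3-mod i 1 j ⟩
    1 + j * (3 ^ suc i * 1)       ≡⟨ cong (λ t → 1 + j * t) (*-identityʳ (3 ^ suc i)) ⟩
    1 + j * 3 ^ suc i             ∎
    where open ≡-mod-Reasoning (3 ^ suc (suc i))

  power-period : ∀ i j w → let b = 1 + 3 * w in
    b ^ 2 ^ (j * (2 * 3 ^ i)) ≡ b + 3 ^ suc (suc i) * (j * w) mod 3 ^ suc (suc (suc i))
  power-period i j w with two-power-period i j
  ... | congruent r 2^jT≡ = begin
    b ^ 2 ^ (j * (2 * 3 ^ i))                   ≡⟨ cong (b ^_) 2^jT≡ ⟩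
    b ^ (1 + j * Q + P * r)                     ≡⟨ split ⟩
    b * (b ^ Q) ^ j * (b ^ P) ^ r               ∼⟨ *-cong-mod (*-congˡ-mod b [b^Q]^j) [b^P]^r ⟩
    b * (1 + j * (P * w)) * 1                   ≡⟨ expand w j P ⟩
    b + P * (j * w) + 3 * P * (j * w * w)       ∼⟨ congruent _ refl ⟩
    b + P * (j * w)                             ∎
    where
    open ≡-mod-Reasoning (3 ^ suc (suc (suc i)))
    b = 1 + 3 * w
    Q = 3 ^ suc i
    P = 3 ^ suc (suc i)
    split : b ^ (1 + j * Q + P * r) ≡ b * (b ^ Q) ^ j * (b ^ P) ^ r
    split = trans (^-distribˡ-+-* b (1 + j * Q) (P * r))
      (cong₂ (λ s t → b * s * t) (trans (cong (b ^_) (*-comm j Q)) (sym (^-*-assoc b Q j))) (sym (^-*-assoc b P r)))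
    [b^Q]^j : (b ^ Q) ^ j ≡ 1 + j * (P * w) mod 3 * P
    [b^Q]^j = ≡-mod-trans (^-cong-mod j (lifting-the-exponent (suc i) w)) (binomial-3-mod (suc i) w j)
    [b^P]^r : (b ^ P) ^ r ≡ 1 mod 3 * P
    [b^P]^r = ≡-mod-trans (^-cong-mod r b^P≡1) (≡⇒≡-mod (^-zeroˡ r))
      where
      b^P≡1 : b ^ P ≡ 1 mod 3 * P
      b^P≡1 = ≡-mod-trans (≡-mod-weaken (n∣m*n 3) (lifting-the-exponent (suc (suc i)) w)) (congruent w refl)
    expand : ∀ w j P → (1 + 3 * w) * (1 + j * (P * w)) * 1 ≡ 1 + 3 * w + P * (j * w) + 3 * P * (j * w * w)
    expand = solve-∀

  u : ℕ → ℕ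
  u n = 4 ^ 2 ^ n

  u-shift : ∀ n k → u (n + k) ≡ u n ^ 2 ^ k
  u-shift n k = trans (cong (4 ^_) (^-distribˡ-+-* 2 n k)) (sym (^-*-assoc 4 (2 ^ n) (2 ^ k)))

  u-split : ∀ n → ∃ λ w → u n ≡ 1 + 3 * w × ¬ 3 ∣ w
  u-split zero    = 1 , refl , λ 3∣1 → case ∣1⇒≡1 3∣1 of λ ()
  u-split (suc n) with u-split n
  ... | w , uₙ≡ , 3∤w = 3 * (w * w) + 2 * w , uₙ₊₁≡ , 3∤w′
    where
    uₙ₊₁≡ : u (suc n) ≡ 1 + 3 * (3 * (w * w) + 2 * w)
    uₙ₊₁≡ = begin
      4 ^ (2 * 2 ^ n)       ≡⟨ cong (4 ^_) (*-comm 2 (2 ^ n)) ⟩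
      4 ^ (2 ^ n * 2)       ≡⟨ ^-*-assoc 4 (2 ^ n) 2 ⟨
      u n ^ 2               ≡⟨ cong (_^ 2) uₙ≡ ⟩
      (1 + 3 * w) ^ 2       ≡⟨ square w ⟩
      1 + 3 * (3 * (w * w) + 2 * w) ∎
      where
      open ≡-Reasoning
      square : ∀ w → (1 + 3 * w) * ((1 + 3 * w) * 1) ≡ 1 + 3 * (3 * (w * w) + 2 * w)
      square = solve-∀
    3∤w′ : ¬ 3 ∣ 3 * (w * w) + 2 * w
    -- m∣m*n w : 3 ∣ 3 * w, which unfolds to w + 2 * w.
    3∤w′ 3∣w′ = 3∤w (∣m+n∣m⇒∣n (subst (3 ∣_) (+-comm w (2 * w)) (m∣m*n w)) 3∣2w)
      where
      3∣2w : 3 ∣ 2 * w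
      3∣2w = ∣m+n∣m⇒∣n 3∣w′ (m∣m*n (w * w))

  u-period : ∀ i n j w → u n ≡ 1 + 3 * w →
             u (n + j * (2 * 3 ^ i)) ≡ u n + 3 ^ suc (suc i) * (j * w) mod 3 ^ suc (suc (suc i))
  u-period i n j w uₙ≡ rewrite u-shift n (j * (2 * 3 ^ i)) | uₙ≡ = power-period i j w

module Hensel where
  open PowersOfFour
  open import Data.Nat as ℕ using (ℕ; zero; suc; z≤n; s≤s)
  import Data.Nat.Properties as ℕ
  open import Data.Nat.Divisibility as ℕ using (divides; m%n≡0⇒n∣m; m∣m*n; n∣m*n)
  open import Data.Nat.DivMod using (_%_; _/_; m≡m%n+[m/n]*n; m%n<n)
  open import Data.Nat.Tactic.RingSolver renaming (solve-∀ to ℕ-solve-∀) using ()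
  open import Data.Fin using (Fin; zero; suc; toℕ)
  open import Data.Fin.Properties using (toℕ≤pred[n])
  open import Data.Integer hiding (suc; _%_; _/_)
  open import Data.Integer.Properties using (pos-+; pos-*; +-assoc; *-comm)
  open import Data.Integer.DivMod using (_%ℕ_; _/ℕ_; a≡a%ℕn+[a/ℕn]*n; n%ℕd<d)
  open import Data.Integer.Divisibility.Signed
  open import Data.Integer.Tactic.RingSolver using (solve-∀; solve)
  open import Data.Integer.Solver using (module +-*-Solver)
  open import Data.List using (List; []; _∷_)
  open import Data.Product
  open import Relation.Nullary using (¬_; Dec; yes; no; contradiction)
  open import Relation.Binary.PropositionalEquality

  -- Polynomials are coefficient lists, constant term first; ⟦ p ⟧′ is the formal derivative.
  ⟦_⟧ : List ℤ → ℤ → ℤ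
  ⟦ [] ⟧    x = 0ℤ
  ⟦ c ∷ p ⟧ x = c + x * ⟦ p ⟧ x

  ⟦_⟧′ : List ℤ → ℤ → ℤ
  ⟦ [] ⟧′    x = 0ℤ
  ⟦ c ∷ p ⟧′ x = ⟦ p ⟧ x + x * ⟦ p ⟧′ x

  taylor : ∀ p x h → ∃ λ r → ⟦ p ⟧ (x + h) ≡ ⟦ p ⟧ x + h * ⟦ p ⟧′ x + h * h * r
  taylor []      x h = 0ℤ , solve (h ∷ [])
  taylor (c ∷ p) x h with taylor p x h
  ... | r , eq =
    ⟦ p ⟧′ x + (x + h) * r , trans (cong (λ t → c + (x + h) * t) eq) (expand c x h (⟦ p ⟧ x) (⟦ p ⟧′ x) r)
    where
    expand : ∀ c x h E D r →
      c + (x + h) * (E + h * D + h * h * r) ≡ c + x * E + h * (E + x * D) + h * h * (D + (x + h) * r)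
    expand = solve-∀

  ⟦⟧′-shift : ∀ p x h → ∃ λ s → ⟦ p ⟧′ (x + h) ≡ ⟦ p ⟧′ x + h * s
  ⟦⟧′-shift []      x h = 0ℤ , solve (h ∷ [])
  ⟦⟧′-shift (c ∷ p) x h with taylor p x h | ⟦⟧′-shift p x h
  ... | r , eq | s , eq′ =
    D + h * r + D + (x + h) * s , trans (cong₂ (λ t t′ → t + (x + h) * t′) eq eq′) (expand x h (⟦ p ⟧ x) D r s)
    where
    D = ⟦ p ⟧′ x
    expand : ∀ x h E D r s →
      E + h * D + h * h * r + (x + h) * (D + h * s) ≡ E + x * D + h * (D + h * r + D + (x + h) * s)
    expand = solve-∀

  -- Q̂₉ z is (z + + 1) * g z by definition.
  g : ℤ → ℤ
  g z = z ^ 8 - z ^ 6 + z ^ 2 + + 2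

  g-coefficients : List ℤ
  g-coefficients = + 2 ∷ 0ℤ ∷ + 1 ∷ 0ℤ ∷ 0ℤ ∷ 0ℤ ∷ -1ℤ ∷ 0ℤ ∷ + 1 ∷ []

  -- The syntactic solver interprets _^_, unlike the reflective one.
  g-horner : ∀ z → g z ≡ ⟦ g-coefficients ⟧ z
  g-horner = solve-syntactically 1 (λ z → z :^ 8 :- z :^ 6 :+ z :^ 2 :+ con (+ 2) :=
    con (+ 2) :+ z :* (con 0ℤ :+ z :* (con (+ 1) :+ z :* (con 0ℤ :+ z :* (con 0ℤ :+ z :*
      (con 0ℤ :+ z :* (con -1ℤ :+ z :* (con 0ℤ :+ z :* (con (+ 1) :+ z :* con 0ℤ))))))))) refl
    where open +-*-Solver renaming (solve to solve-syntactically)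

  -- g′ 1 = 4 ≡ 1 (mod 3), so a step 3 d away from 1 + 3 w moves g by 3 d modulo 9 d.
  g-shift : ∀ w d → ∃ λ k → g (+ 1 + + 3 * w + + 3 * d) ≡ g (+ 1 + + 3 * w) + + 3 * d + + 9 * d * k
  g-shift w d =
    let (r , taylor-at-x) = taylor g-coefficients x (+ 3 * d)
        (s , g′-near-1)   = ⟦⟧′-shift g-coefficients (+ 1) (+ 3 * w)
    in + 1 + w * s + d * r , (begin
      g (x + + 3 * d)                                                   ≡⟨ g-horner (x + + 3 * d) ⟩
      ⟦ g-coefficients ⟧ (x + + 3 * d)                                  ≡⟨ taylor-at-x ⟩
      ⟦ g-coefficients ⟧ x + + 3 * d * ⟦ g-coefficients ⟧′ x + + 3 * d * (+ 3 * d) * r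
        ≡⟨ cong (λ t → ⟦ g-coefficients ⟧ x + + 3 * d * t + + 3 * d * (+ 3 * d) * r) g′-near-1 ⟩
      ⟦ g-coefficients ⟧ x + + 3 * d * (+ 4 + + 3 * w * s) + + 3 * d * (+ 3 * d) * r
        ≡⟨ expand (⟦ g-coefficients ⟧ x) w d r s ⟩
      ⟦ g-coefficients ⟧ x + + 3 * d + + 9 * d * (+ 1 + w * s + d * r)
        ≡⟨ cong (λ t → t + + 3 * d + + 9 * d * (+ 1 + w * s + d * r)) (g-horner x) ⟨
      g x + + 3 * d + + 9 * d * (+ 1 + w * s + d * r)                   ∎)
    where
    open ≡-Reasoning
    x = + 1 + + 3 * w
    expand : ∀ G w d r s →
      G + + 3 * d * (+ 4 + + 3 * w * s) + + 3 * d * (+ 3 * d) * r ≡ G + + 3 * d + + 9 * d * (+ 1 + w * s + d * r)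
    expand = solve-∀

  pos-^ : ∀ m k → (+ m) ^ k ≡ + (m ℕ.^ k)
  pos-^ m zero    = refl
  pos-^ m (suc k) = trans (cong (+ m *_) (pos-^ m k)) (sym (pos-* m (m ℕ.^ k)))

  pos-+-* : ∀ a b c → + (a ℕ.+ b ℕ.* c) ≡ + a + + b * + c
  pos-+-* a b c = trans (pos-+ a (b ℕ.* c)) (cong (_+_ (+ a)) (pos-* b c))

  +[b^m]∣+[b^n] : ∀ b {m n} → m ℕ.≤ n → + (b ℕ.^ m) ∣ + (b ℕ.^ n)
  +[b^m]∣+[b^n] b {m} m≤n with ℕ.m≤n⇒∃[o]m+o≡n m≤n
  ... | o , refl = ∣ᵤ⇒∣ (subst (b ℕ.^ m ℕ.∣_) (sym (ℕ.^-distribˡ-+-* b m o)) (m∣m*n (b ℕ.^ o)))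

  residue-table : ∀ r s → r ℕ.< 3 → s ℕ.< 3 → s ≢ 0 → ∃ λ (j : Fin 3) → 3 ℕ.∣ r ℕ.+ toℕ j ℕ.* s
  residue-table 0 s _ _ _ = zero , divides 0 refl
  residue-table 1 1 _ _ _ = suc (suc zero) , divides 1 refl
  residue-table 1 2 _ _ _ = suc zero , divides 1 refl
  residue-table 2 1 _ _ _ = suc zero , divides 1 refl
  residue-table 2 2 _ _ _ = suc (suc zero) , divides 2 refl
  residue-table _ 0 _ _ s≢0 = contradiction refl s≢0
  residue-table (suc (suc (suc _))) _ (s≤s (s≤s (s≤s ()))) _ _
  residue-table _ (suc (suc (suc _))) _ (s≤s (s≤s (s≤s ()))) _

  cancel-mod-3 : ∀ c w → ¬ 3 ℕ.∣ w → ∃ λ (j : Fin 3) → + 3 ∣ c + + toℕ j * + w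
  cancel-mod-3 c w 3∤w =
    let (j , 3∣r+js) = residue-table r s (n%ℕd<d c 3) (m%n<n w 3) (λ s≡0 → 3∤w (m%n≡0⇒n∣m w 3 s≡0))
    in j , subst (+ 3 ∣_) (sym (split (toℕ j)))
             (∣m∣n⇒∣m+n {m = + (r ℕ.+ toℕ j ℕ.* s)} (∣ᵤ⇒∣ 3∣r+js) (∣n⇒∣m*n (c /ℕ 3 + + toℕ j * + (w / 3)) ∣-refl))
    where
    r = c %ℕ 3
    s = w % 3
    split : ∀ j → c + + j * + w ≡ + (r ℕ.+ j ℕ.* s) + (c /ℕ 3 + + j * + (w / 3)) * + 3
    split j = begin
      c + + j * + w
        ≡⟨ cong₂ (λ a b → a + + j * b) (a≡a%ℕn+[a/ℕn]*n c 3)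
                 (trans (cong +_ (m≡m%n+[m/n]*n w 3)) (pos-+-* s (w / 3) 3)) ⟩
      + r + c /ℕ 3 * + 3 + + j * (+ s + + (w / 3) * + 3)   ≡⟨ regroup (+ r) (c /ℕ 3) (+ j) (+ s) (+ (w / 3)) ⟩
      + r + + j * + s + (c /ℕ 3 + + j * + (w / 3)) * + 3
        ≡⟨ cong (_+ (c /ℕ 3 + + j * + (w / 3)) * + 3) (pos-+-* r j s) ⟨
      + (r ℕ.+ j ℕ.* s) + (c /ℕ 3 + + j * + (w / 3)) * + 3  ∎
      where
      open ≡-Reasoning
      regroup : ∀ r q j s t → r + q * + 3 + j * (s + t * + 3) ≡ r + j * s + (q + j * t) * + 3
      regroup = solve-∀

  x : ℕ → ℤ
  x n = (+ 2) ^ (2 ℕ.^ suc n)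

  x≡u : ∀ n → x n ≡ + u n
  x≡u n = trans (pos-^ 2 (2 ℕ.^ suc n)) (cong +_ (sym (ℕ.^-*-assoc 2 2 (2 ℕ.^ n))))

  3∣x-1 : ∀ n → + 3 ∣ x n - + 1
  3∣x-1 n =
    let (w , uₙ≡ , _) = u-split n
    in divides (+ w) (begin
      x n - + 1                ≡⟨ cong (_- + 1) (trans (x≡u n) (trans (cong +_ uₙ≡) (pos-+-* 1 3 w))) ⟩
      + 1 + + 3 * + w - + 1    ≡⟨ cancel (+ w) ⟩
      + w * + 3                ∎)
    where
    open ≡-Reasoning
    cancel : ∀ w → + 1 + + 3 * w - + 1 ≡ w * + 3
    cancel = solve-∀

  3^n∣prodFactor : ∀ n → + (3 ℕ.^ n) ∣ prodFactor (+ 2) n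
  3^n∣prodFactor zero    = ∣-refl
  3^n∣prodFactor (suc n) =
    subst (_∣ prodFactor (+ 2) (suc n)) (sym (trans (pos-* 3 (3 ℕ.^ n)) (*-comm (+ 3) (+ (3 ℕ.^ n)))))
      (∣-trans (*-monoʳ-∣ (+ (3 ℕ.^ n)) (3∣x-1 n)) (*-monoˡ-∣ (x n - + 1) (3^n∣prodFactor n)))

  x-period : ∀ i n j w → u n ≡ 1 ℕ.+ 3 ℕ.* w → ∃ λ r →
    x (n ℕ.+ j ℕ.* (2 ℕ.* 3 ℕ.^ i)) ≡ + 1 + + 3 * + w + + 3 * + (3 ℕ.^ suc i ℕ.* (j ℕ.* w ℕ.+ 3 ℕ.* r))
  x-period i n j w uₙ≡ =
    let congruent r uₙ′≡ = u-period i n j w uₙ≡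
        n′ = n ℕ.+ j ℕ.* (2 ℕ.* 3 ℕ.^ i)
        D = Q ℕ.* (j ℕ.* w ℕ.+ 3 ℕ.* r)
    in r , (begin
      x n′                                                         ≡⟨ x≡u n′ ⟩
      + u n′                                                       ≡⟨ cong +_ uₙ′≡ ⟩
      + (u n ℕ.+ 3 ℕ.* Q ℕ.* (j ℕ.* w) ℕ.+ 3 ℕ.* (3 ℕ.* Q) ℕ.* r)
        ≡⟨ cong (λ t → + (t ℕ.+ 3 ℕ.* Q ℕ.* (j ℕ.* w) ℕ.+ 3 ℕ.* (3 ℕ.* Q) ℕ.* r)) uₙ≡ ⟩
      + (1 ℕ.+ 3 ℕ.* w ℕ.+ 3 ℕ.* Q ℕ.* (j ℕ.* w) ℕ.+ 3 ℕ.* (3 ℕ.* Q) ℕ.* r)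
        ≡⟨ cong +_ (regroup Q w j r) ⟩
      + (1 ℕ.+ 3 ℕ.* w ℕ.+ 3 ℕ.* D)                               ≡⟨ pos-+-* (1 ℕ.+ 3 ℕ.* w) 3 D ⟩
      + (1 ℕ.+ 3 ℕ.* w) + + 3 * + D                               ≡⟨ cong (_+ + 3 * + D) (pos-+-* 1 3 w) ⟩
      + 1 + + 3 * + w + + 3 * + D                                 ∎)
    where
    open ≡-Reasoning
    Q = 3 ℕ.^ suc i
    regroup : ∀ Q w j r → 1 ℕ.+ 3 ℕ.* w ℕ.+ 3 ℕ.* Q ℕ.* (j ℕ.* w) ℕ.+ 3 ℕ.* (3 ℕ.* Q) ℕ.* r
                       ≡ 1 ℕ.+ 3 ℕ.* w ℕ.+ 3 ℕ.* (Q ℕ.* (j ℕ.* w ℕ.+ 3 ℕ.* r))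
    regroup = ℕ-solve-∀

  g∘x-period : ∀ i n j w → u n ≡ 1 ℕ.+ 3 ℕ.* w → ∃ λ k →
    g (x (n ℕ.+ j ℕ.* (2 ℕ.* 3 ℕ.^ i)))
      ≡ g (x n) + + (3 ℕ.^ suc (suc i) ℕ.* (j ℕ.* w)) + + (3 ℕ.^ suc (suc (suc i))) * k
  g∘x-period i n j w uₙ≡ =
    let (r , xₙ′≡) = x-period i n j w uₙ≡
        D = Q ℕ.* (j ℕ.* w ℕ.+ 3 ℕ.* r)
        (K , g-step) = g-shift (+ w) (+ D)
    in + r + + (j ℕ.* w ℕ.+ 3 ℕ.* r) * K , (begin
      g (x (n ℕ.+ j ℕ.* (2 ℕ.* 3 ℕ.^ i)))                 ≡⟨ cong g xₙ′≡ ⟩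
      g (+ 1 + + 3 * + w + + 3 * + D)                     ≡⟨ g-step ⟩
      g (+ 1 + + 3 * + w) + + 3 * + D + + 9 * + D * K     ≡⟨ cong (λ t → g t + + 3 * + D + + 9 * + D * K) xₙ≡ ⟨
      g (x n) + + 3 * + D + + 9 * + D * K                 ≡⟨ rescale (g (x n)) r K ⟩
      g (x n) + + (3 ℕ.* Q ℕ.* (j ℕ.* w)) + + (3 ℕ.* (3 ℕ.* Q)) * (+ r + + (j ℕ.* w ℕ.+ 3 ℕ.* r) * K) ∎)
    where
    open ≡-Reasoning
    Q = 3 ℕ.^ suc i
    jw = j ℕ.* w
    xₙ≡ : x n ≡ + 1 + + 3 * + w
    xₙ≡ = trans (x≡u n) (trans (cong +_ uₙ≡) (pos-+-* 1 3 w))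
    rescale : ∀ G r K → let D = Q ℕ.* (jw ℕ.+ 3 ℕ.* r) in
      G + + 3 * + D + + 9 * + D * K ≡ G + + (3 ℕ.* Q ℕ.* jw) + + (3 ℕ.* (3 ℕ.* Q)) * (+ r + + (jw ℕ.+ 3 ℕ.* r) * K)
    rescale G r K = begin
      G + + 3 * + (Q ℕ.* (jw ℕ.+ 3 ℕ.* r)) + + 9 * + (Q ℕ.* (jw ℕ.+ 3 ℕ.* r)) * K
        ≡⟨ cong (λ t → G + + 3 * t + + 9 * t * K)
                (trans (pos-* Q (jw ℕ.+ 3 ℕ.* r)) (cong (+ Q *_) (pos-+-* jw 3 r))) ⟩
      G + + 3 * (+ Q * (+ jw + + 3 * + r)) + + 9 * (+ Q * (+ jw + + 3 * + r)) * K
        ≡⟨ collect G (+ Q) (+ jw) (+ r) K ⟩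
      G + + 3 * + Q * + jw + + 3 * (+ 3 * + Q) * (+ r + (+ jw + + 3 * + r) * K)
        ≡⟨ cong₃ (trans (pos-* (3 ℕ.* Q) jw) (cong (_* + jw) (pos-* 3 Q)))
                 (trans (pos-* 3 (3 ℕ.* Q)) (cong (+ 3 *_) (pos-* 3 Q))) (pos-+-* jw 3 r) ⟨
      G + + (3 ℕ.* Q ℕ.* jw) + + (3 ℕ.* (3 ℕ.* Q)) * (+ r + + (jw ℕ.+ 3 ℕ.* r) * K) ∎
      where
      cong₃ : ∀ {a a′ b b′ c c′} → a ≡ a′ → b ≡ b′ → c ≡ c′ →
              G + a + b * (+ r + c * K) ≡ G + a′ + b′ * (+ r + c′ * K)
      cong₃ refl refl refl = refl
      collect : ∀ G Q jw r K → G + + 3 * (Q * (jw + + 3 * r)) + + 9 * (Q * (jw + + 3 * r)) * K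
                            ≡ G + + 3 * Q * jw + + 3 * (+ 3 * Q) * (r + (jw + + 3 * r) * K)
      collect = solve-∀

  root-lift : ∀ i n j w c → u n ≡ 1 ℕ.+ 3 ℕ.* w → g (x n) ≡ c * + (3 ℕ.^ suc (suc i)) → + 3 ∣ c + + j * + w →
              + (3 ℕ.^ suc (suc (suc i))) ∣ g (x (n ℕ.+ j ℕ.* (2 ℕ.* 3 ℕ.^ i)))
  root-lift i n j w c uₙ≡ gxₙ≡ 3∣c+jw =
    let (k , gxₙ′≡) = g∘x-period i n j w uₙ≡
    in subst (+ (3 ℕ.* P) ∣_) (sym (trans gxₙ′≡ (cong (_+ + (3 ℕ.* P) * k) (factor-out k))))
         (∣m∣n⇒∣m+n 3P∣[c+jw]P (∣m⇒∣m*n k ∣-refl))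
    where
    P = 3 ℕ.^ suc (suc i)
    3P∣[c+jw]P : + (3 ℕ.* P) ∣ (c + + j * + w) * + P
    3P∣[c+jw]P = subst (_∣ (c + + j * + w) * + P) (sym (pos-* 3 P)) (*-monoˡ-∣ (+ P) 3∣c+jw)
    factor-out : ∀ k → g (x n) + + (P ℕ.* (j ℕ.* w)) ≡ (c + + j * + w) * + P
    factor-out k = begin
      g (x n) + + (P ℕ.* (j ℕ.* w))
        ≡⟨ cong₂ _+_ gxₙ≡ (trans (pos-* P (j ℕ.* w)) (cong (+ P *_) (pos-* j w))) ⟩
      c * + P + + P * (+ j * + w)         ≡⟨ factor c (+ P) (+ j * + w) ⟩
      (c + + j * + w) * + P               ∎
      where
      open ≡-Reasoning
      factor : ∀ c P t → c * P + P * t ≡ (c + t) * P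
      factor = solve-∀

  root-periodic : ∀ i n w → u n ≡ 1 ℕ.+ 3 ℕ.* w → + (3 ℕ.^ suc (suc i)) ∣ g (x n) →
                  + (3 ℕ.^ suc (suc i)) ∣ g (x (n ℕ.+ 2 ℕ.* 3 ℕ.^ i))
  root-periodic i n w uₙ≡ P∣gxₙ =
    let (k , gxₙ′≡) = g∘x-period i n 1 w uₙ≡
    in subst (λ t → + P ∣ g (x (n ℕ.+ t))) (ℕ.*-identityˡ (2 ℕ.* 3 ℕ.^ i))
         (subst (+ P ∣_) (sym gxₙ′≡) (∣m∣n⇒∣m+n (∣m∣n⇒∣m+n P∣gxₙ P∣Pw) (∣m⇒∣m*n k P∣3P)))
    where
    P = 3 ℕ.^ suc (suc i)
    P∣Pw : + P ∣ + (P ℕ.* (1 ℕ.* w))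
    P∣Pw = ∣ᵤ⇒∣ (m∣m*n (1 ℕ.* w))
    P∣3P : + P ∣ + (3 ℕ.* P)
    P∣3P = ∣ᵤ⇒∣ (n∣m*n 3)

  shift-bound : ∀ i {n} (j : Fin 3) → n ℕ.< 2 ℕ.* 3 ℕ.^ i →
                n ℕ.+ toℕ j ℕ.* (2 ℕ.* 3 ℕ.^ i) ℕ.< 2 ℕ.* 3 ℕ.^ suc i
  shift-bound i j n<T = ℕ.<-≤-trans (ℕ.+-mono-<-≤ n<T (ℕ.*-monoˡ-≤ (2 ℕ.* 3 ℕ.^ i) (toℕ≤pred[n] j)))
                                    (ℕ.≤-reflexive (trans (sym (ℕ.*-assoc 3 2 (3 ℕ.^ i))) (ℕ.*-assoc 2 3 (3 ℕ.^ i))))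

  bounded-root : ∀ i → ∃ λ n → n ℕ.< 2 ℕ.* 3 ℕ.^ i × + (3 ℕ.^ suc (suc i)) ∣ g (x n)
  bounded-root zero    = 1 , s≤s (s≤s z≤n) , divides (+ 475354482) refl
  bounded-root (suc i) =
    let (n , n<T , divides c gxₙ≡) = bounded-root i
        (w , uₙ≡ , 3∤w)            = u-split n
        (j , 3∣c+jw)               = cancel-mod-3 c w 3∤w
    in n ℕ.+ toℕ j ℕ.* (2 ℕ.* 3 ℕ.^ i) , shift-bound i j n<T , root-lift i n (toℕ j) w c uₙ≡ gxₙ≡ 3∣c+jw

  2+i≤3^[1+i] : ∀ i → 2 ℕ.+ i ℕ.≤ 3 ℕ.^ suc i
  2+i≤3^[1+i] zero    = s≤s (s≤s z≤n)
  2+i≤3^[1+i] (suc i) = ℕ.+-mono-≤ (ℕ.m^n>0 3 (suc i)) (ℕ.≤-trans (2+i≤3^[1+i] i) (ℕ.m≤m+n _ _))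

  root-in-range : ∀ i → ∃ λ n → 3 ℕ.+ i ℕ.≤ n × n ℕ.≤ 3 ℕ.^ (2 ℕ.+ i) × + (3 ℕ.^ (3 ℕ.+ i)) ∣ g (x n)
  root-in-range i =
    let (n , n<2q , 3^[3+i]∣gxₙ) = bounded-root (suc i) in enlarge n n<2q 3^[3+i]∣gxₙ (3 ℕ.+ i ℕ.≤? n)
    where
    q = 3 ℕ.^ suc i
    enlarge : ∀ n → n ℕ.< 2 ℕ.* q → + (3 ℕ.^ (3 ℕ.+ i)) ∣ g (x n) → Dec (3 ℕ.+ i ℕ.≤ n) →
              ∃ λ n → 3 ℕ.+ i ℕ.≤ n × n ℕ.≤ 3 ℕ.* q × + (3 ℕ.^ (3 ℕ.+ i)) ∣ g (x n)
    enlarge n n<2q ∣gxₙ (yes 3+i≤n) =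
      n , 3+i≤n , ℕ.≤-trans (ℕ.<⇒≤ n<2q) (ℕ.*-monoˡ-≤ q {2} {3} (s≤s (s≤s z≤n))) , ∣gxₙ
    enlarge n n<2q ∣gxₙ (no 3+i≰n)  =
      let (w , uₙ≡ , _) = u-split n
      in n ℕ.+ 2 ℕ.* q , lower , upper , root-periodic (suc i) n w uₙ≡ ∣gxₙ
      where
      lower : 3 ℕ.+ i ℕ.≤ n ℕ.+ 2 ℕ.* q
      lower = ℕ.≤-trans (ℕ.+-mono-≤ (ℕ.m^n>0 3 (suc i)) (ℕ.≤-trans (2+i≤3^[1+i] i) (ℕ.m≤m+n q 0)))
                        (ℕ.m≤n+m _ n)
      upper : n ℕ.+ 2 ℕ.* q ℕ.≤ 3 ℕ.* q
      upper = ℕ.+-monoˡ-≤ (2 ℕ.* q) (ℕ.≤-trans (ℕ.s≤s⁻¹ (ℕ.≰⇒> 3+i≰n)) (2+i≤3^[1+i] i))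

open import Data.Nat using (ℕ; zero; suc; s≤s; _≤_; _∸_; _^_)
open import Data.Integer using (+_; _+_)
open import Data.Integer.Divisibility using (_∣_)
import Data.Integer.Divisibility.Signed as Signed
open import Data.Product using (∃-syntax; _×_; _,_)
open Hensel using (x; root-in-range; +[b^m]∣+[b^n]; 3^n∣prodFactor)

lemma6 : (m : ℕ) → 3 ≤ m →
    ∃[ n ] (n ≤ 3 ^ (m ∸ 1) × (+ (3 ^ m) ∣ P̃ n (+ 2)) × (+ (3 ^ m) ∣ Q̃ n (+ 2)))
lemma6 zero ()
lemma6 (suc zero) (s≤s ())
lemma6 (suc (suc zero)) (s≤s (s≤s ()))
lemma6 (suc (suc (suc i))) _ =
  let (n , 3+i≤n , n≤3^[2+i] , 3^m∣g[xₙ]) = root-in-range i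
      3^m∣P̃ = Signed.∣m⇒∣m*n (P̂₉ (x n)) (Signed.∣-trans (+[b^m]∣+[b^n] 3 3+i≤n) (3^n∣prodFactor n))
      3^m∣Q̃ = Signed.∣n⇒∣m*n (x n + + 1) 3^m∣g[xₙ]
  in n , n≤3^[2+i] , Signed.∣⇒∣ᵤ 3^m∣P̃ , Signed.∣⇒∣ᵤ 3^m∣Q̃
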